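{- Let $G$ and $H$ be finite connected graphs, each with at least two vertices. Then $\mathrm{rc}(G\circ H)=\mathrm{rc}(G)$ if $\mathrm{rc}(G)\ge 1$, and $\mathrm{rc}(G\circ H)=\min\{1,\mathrm{rc}(H)\}$ if $\mathrm{rc}(G)=0$.
   Context: The lexicographic product $G\circ H$ has vertex set $V(G)\times V(H)$, with $(g_1,h_1)$ adjacent to $(g_2,h_2)$ iff $g_1g_2\in E(G)$, or ($g_1=g_2$ and $h_1h_2\in E(H)$). Cop and robber game with radius of capture $k$: first the cop chooses a vertex, then the robber; afterwards, starting with the cop, the players alternately either move to an adjacent vertex or stay put, both knowing both positions. The cop wins if at some point the distance between the players is at most $k$. $\mathcal{CWRC}(k)$ is the class of graphs on which the cop has a winning strategy. $\mathrm{rc}(G)=\min\{k\in\mathbb{N}_0 \mid G\in\mathcal{CWRC}(k)\}$. -}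

module Defs where

open import Data.Nat using (ℕ; zero; suc; _≤_)
open import Data.Product using (Σ; ∃; _×_; _,_)
open import Data.Sum using (_⊎_; inj₁; inj₂)
open import Data.Empty using (⊥)
open import Relation.Nullary using (¬_)
open import Relation.Binary.PropositionalEquality using (_≡_; refl; sym)

record Graph (V : Set) : Set₁ where
  field
    Adj     : V → V → Set
    Adj-sym : ∀ {u v} → Adj u v → Adj v u
    Adj-irr : ∀ {u} → ¬ Adj u u
open Graph public

module _ {V : Set} (G : Graph V) where

  data Walk : V → V → ℕ → Set where
    here : ∀ {u} → Walk u u 0
    step : ∀ {u w v n} → Adj G u w → Walk w v n → Walk u v (suc n)

  Connected : Set
  Connected = ∀ u v → ∃ λ n → Walk u v n

  DistLe : V → V → ℕ → Set
  DistLe u v k = ∃ λ n → n ≤ k × Walk u v n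

  Step : V → V → Set
  Step u v = u ≡ v ⊎ Adj G u v

  -- Cop and robber game with radius of capture k (inductive = cop wins in finitely many moves).
  mutual
    data CopTurn (k : ℕ) (c r : V) : Set where
      caught  : DistLe c r k → CopTurn k c r
      copMove : (c' : V) → Step c c' → RobTurn k c' r → CopTurn k c r

    data RobTurn (k : ℕ) (c r : V) : Set where
      caught  : DistLe c r k → RobTurn k c r
      robMove : ((r' : V) → Step r r' → CopTurn k c r') → RobTurn k c r

  CWRC : ℕ → Set
  CWRC k = ∃ λ c → (r : V) → CopTurn k c r

  IsRc : ℕ → Set
  IsRc k = CWRC k × (∀ j → CWRC j → k ≤ j)

lexProd : ∀ {A B : Set} → Graph A → Graph B → Graph (A × B)
lexProd {A} {B} G H = record { Adj = adj ; Adj-sym = s ; Adj-irr = i }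
  where
  adj : A × B → A × B → Set
  adj (g₁ , h₁) (g₂ , h₂) = Adj G g₁ g₂ ⊎ (g₁ ≡ g₂ × Adj H h₁ h₂)
  s : ∀ {u v} → adj u v → adj v u
  s (inj₁ a) = inj₁ (Adj-sym G a)
  s (inj₂ (refl , a)) = inj₂ (refl , Adj-sym H a)
  i : ∀ {u} → ¬ adj u u
  i (inj₁ a) = Adj-irr G a
  i (inj₂ (_ , a)) = Adj-irr H a

module Submission where

open import Defs
open import Data.Nat using (ℕ; zero; suc; _≤_; _⊓_; z≤n; s≤s)
open import Data.Nat.Properties using (≤-trans; ≤-refl; n≤1+n; n≮0)
open import Data.Fin using (Fin; zero; punchIn)
open import Data.Fin.Properties using (punchInᵢ≢i)
open import Data.Product using (_×_; _,_; proj₂; ∃)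
open import Data.Sum using (inj₁; inj₂)
open import Data.Empty using (⊥-elim)
open import Function using (_∘_)
open import Relation.Nullary using (¬_)
open import Relation.Binary.PropositionalEquality using (_≡_; _≢_; refl; sym; subst)

-- The cop on G ∘ H can follow a winning strategy of G on the G-coordinates
-- (the "shadows") while staying in one layer, since every robber move projects
-- to a move in G. When the shadows meet, a radius k ≥ 1 suffices to finish:
-- the cop steps to a neighbouring column, which is adjacent to the whole column
-- of the robber. Conversely, any strategy on G ∘ H projects to one on G against
-- a robber who stays in one layer, so rc(G) ≤ rc(G ∘ H).
-- For radius 0 the cop must catch the robber inside a column, i.e. win the
-- game on H there. Leaving the robber's column never helps: the robber may then
-- jump to any vertex of the cop's new column, so the cop would have to win on H
-- from its current vertex against every robber position.

module _ {V : Set} (G : Graph V) where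

  DistLe-refl : ∀ {u k} → DistLe G u u k
  DistLe-refl = 0 , z≤n , here

  DistLe-0⇒≡ : ∀ {u v} → DistLe G u v 0 → u ≡ v
  DistLe-0⇒≡ (zero , _ , here) = refl

  DistLe-mono : ∀ {u v k k′} → k ≤ k′ → DistLe G u v k → DistLe G u v k′
  DistLe-mono k≤k′ (n , n≤k , w) = n , ≤-trans n≤k k≤k′ , w

  DistLe-step : ∀ {u w v k} → Step G u w → DistLe G w v k → DistLe G u v (suc k)
  DistLe-step (inj₁ refl) d = DistLe-mono (n≤1+n _) d
  DistLe-step (inj₂ a) (n , n≤k , w) = suc n , s≤s n≤k , step a w

  Step⇒DistLe-1 : ∀ {u v} → Step G u v → DistLe G u v 1
  Step⇒DistLe-1 s = DistLe-step s DistLe-refl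

  mutual
    CopTurn-mono : ∀ {k k′ c r} → k ≤ k′ → CopTurn G k c r → CopTurn G k′ c r
    CopTurn-mono k≤k′ (caught d) = caught (DistLe-mono k≤k′ d)
    CopTurn-mono k≤k′ (copMove c′ s t) = copMove c′ s (RobTurn-mono k≤k′ t)

    RobTurn-mono : ∀ {k k′ c r} → k ≤ k′ → RobTurn G k c r → RobTurn G k′ c r
    RobTurn-mono k≤k′ (caught d) = caught (DistLe-mono k≤k′ d)
    RobTurn-mono k≤k′ (robMove f) = robMove λ r′ s → CopTurn-mono k≤k′ (f r′ s)

  CWRC-mono : ∀ {k k′} → k ≤ k′ → CWRC G k → CWRC G k′
  CWRC-mono k≤k′ (c , win) = c , λ r → CopTurn-mono k≤k′ (win r)

  wait : ∀ {k c r} → RobTurn G k c r → CopTurn G k c r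
  wait = copMove _ (inj₁ refl)

  walk-source-has-neighbour : ∀ {u v n} → u ≢ v → Walk G u v n → ∃ (Adj G u)
  walk-source-has-neighbour u≢u here = ⊥-elim (u≢u refl)
  walk-source-has-neighbour _ (step a _) = _ , a

  connected⇒no-isolated : Connected G → (∀ u → ∃ λ v → u ≢ v) → ∀ u → ∃ (Adj G u)
  connected⇒no-isolated connected other u with other u
  ... | v , u≢v = walk-source-has-neighbour u≢v (proj₂ (connected u v))

module _ {A B : Set} (G : Graph A) (H : Graph B) where

  private
    P : Graph (A × B)
    P = lexProd G H

  layer-walk : ∀ {g g′ n} h → Walk G g g′ n → Walk P (g , h) (g′ , h) n
  layer-walk h here = here
  layer-walk h (step a w) = step (inj₁ a) (layer-walk h w)

  lift-walk-suc : ∀ {g g′ h h′ n} →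
                  Walk G g g′ (suc n) → Walk P (g , h) (g′ , h′) (suc n)
  lift-walk-suc {h′ = h′} (step a w) = step (inj₁ a) (layer-walk h′ w)

  column-walk : ∀ {g h h′ n} → Walk H h h′ n → Walk P (g , h) (g , h′) n
  column-walk here = here
  column-walk (step a w) = step (inj₂ (refl , a)) (column-walk w)

  column-DistLe : ∀ {g h h′ k} → DistLe H h h′ k → DistLe P (g , h) (g , h′) k
  column-DistLe (n , n≤k , w) = n , n≤k , column-walk w

  layer-Step : ∀ {g g′ h} → Step G g g′ → Step P (g , h) (g′ , h)
  layer-Step (inj₁ refl) = inj₁ refl
  layer-Step (inj₂ a) = inj₂ (inj₁ a)

  column-Step : ∀ {g h h′} → Step H h h′ → Step P (g , h) (g , h′)
  column-Step (inj₁ refl) = inj₁ refl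
  column-Step (inj₂ a) = inj₂ (inj₂ (refl , a))

  project-Step : ∀ {g g′ h h′} → Step P (g , h) (g′ , h′) → Step G g g′
  project-Step (inj₁ refl) = inj₁ refl
  project-Step (inj₂ (inj₁ a)) = inj₂ a
  project-Step (inj₂ (inj₂ (refl , _))) = inj₁ refl

  project-walk : ∀ {g g′ h h′ n} →
                 Walk P (g , h) (g′ , h′) n → DistLe G g g′ n
  project-walk here = DistLe-refl G
  project-walk (step a w) = DistLe-step G (project-Step (inj₂ a)) (project-walk w)

  project-DistLe : ∀ {g g′ h h′ k} →
                   DistLe P (g , h) (g′ , h′) k → DistLe G g g′ k
  project-DistLe (n , n≤k , w) = DistLe-mono G n≤k (project-walk w)

  mutual
    project-CopTurn : ∀ {k g g′ h h′} →
                      CopTurn P k (g , h) (g′ , h′) → CopTurn G k g g′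
    project-CopTurn (caught d) = caught (project-DistLe d)
    project-CopTurn (copMove _ s t) = copMove _ (project-Step s) (project-RobTurn t)

    project-RobTurn : ∀ {k g g′ h h′} →
                      RobTurn P k (g , h) (g′ , h′) → RobTurn G k g g′
    project-RobTurn (caught d) = caught (project-DistLe d)
    project-RobTurn {h′ = h′} (robMove f) =
      robMove λ g″ s → project-CopTurn (f (g″ , h′) (layer-Step s))

  CWRC-project : ∀ {k} → B → CWRC P k → CWRC G k
  CWRC-project h ((g , _) , win) = g , λ g′ → project-CopTurn (win (g′ , h))

  module Shadow (h₀ : B) {k : ℕ}
                (finish : ∀ {g g′} h → DistLe G g g′ k → RobTurn P k (g , h₀) (g′ , h))
                where
    mutual
      shadow-CopTurn : ∀ {g g′} →
                       CopTurn G k g g′ → ∀ h → CopTurn P k (g , h₀) (g′ , h)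
      shadow-CopTurn (caught d) h = wait P (finish h d)
      shadow-CopTurn (copMove g″ s t) h =
        copMove (g″ , h₀) (layer-Step s) (shadow-RobTurn t h)

      shadow-RobTurn : ∀ {g g′} →
                       RobTurn G k g g′ → ∀ h → RobTurn P k (g , h₀) (g′ , h)
      shadow-RobTurn (caught d) h = finish h d
      shadow-RobTurn (robMove f) h =
        robMove λ { (g″ , h″) s → shadow-CopTurn (f g″ (project-Step s)) h″ }

    shadow-CWRC : CWRC G k → CWRC P k
    shadow-CWRC (g , win) = (g , h₀) , λ { (g′ , h) → shadow-CopTurn (win g′) h }

  module _ (no-isolated : ∀ g → ∃ (Adj G g)) {k : ℕ} (1≤k : 1 ≤ k) where
    catch-CopTurn : ∀ {g g′ h h′} → DistLe G g g′ k → CopTurn P k (g , h) (g′ , h′)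
    catch-CopTurn (suc n , n<k , w) = caught (suc n , n<k , lift-walk-suc w)
    catch-CopTurn {g} {h = h} (zero , _ , here) with no-isolated g
    ... | g″ , g~g″ = copMove (g″ , h) (inj₂ (inj₁ g~g″))
                        (caught (1 , 1≤k , step (inj₁ (Adj-sym G g~g″)) here))

    catch-RobTurn : ∀ {g g′ h h′} → DistLe G g g′ k → RobTurn P k (g , h) (g′ , h′)
    catch-RobTurn (suc n , n<k , w) = caught (suc n , n<k , lift-walk-suc w)
    catch-RobTurn (zero , _ , here) =
      robMove λ { (_ , _) s →
        catch-CopTurn (DistLe-mono G 1≤k (Step⇒DistLe-1 G (project-Step s))) }

    CWRC-lift : B → CWRC G k → CWRC P k
    CWRC-lift h₀ = Shadow.shadow-CWRC h₀ (λ _ → catch-RobTurn)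

  mutual
    column-CopTurn : ∀ {k g h h′} → CopTurn H k h h′ → CopTurn P k (g , h) (g , h′)
    column-CopTurn (caught d) = caught (column-DistLe d)
    column-CopTurn (copMove h″ s t) = copMove (_ , h″) (column-Step s) (column-RobTurn t)

    column-RobTurn : ∀ {k g h h′} → RobTurn H k h h′ → RobTurn P k (g , h) (g , h′)
    column-RobTurn (caught d) = caught (column-DistLe d)
    column-RobTurn (robMove f) = robMove λ
      { (_ , _) (inj₁ refl) → column-CopTurn (f _ (inj₁ refl))
      ; (g′ , h″) (inj₂ (inj₁ g~g′)) →
          copMove (g′ , h″) (inj₂ (inj₁ g~g′)) (caught (DistLe-refl P))
      ; (_ , h″) (inj₂ (inj₂ (refl , a))) → column-CopTurn (f h″ (inj₂ a)) }

  CWRC-0-lexProd : CWRC G 0 → CWRC H 0 → CWRC P 0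
  CWRC-0-lexProd G-win (h₀ , H-win) = Shadow.shadow-CWRC h₀ finish G-win
    where
    finish : ∀ {g g′} h → DistLe G g g′ 0 → RobTurn P 0 (g , h₀) (g′ , h)
    finish h d with DistLe-0⇒≡ G d
    ... | refl = column-RobTurn (robMove λ h′ _ → H-win h′)

  module _ (H-escapes : ¬ CWRC H 0) where
    mutual
      column-CopTurn⁻¹ : ∀ {g h h′} → CopTurn P 0 (g , h) (g , h′) → CopTurn H 0 h h′
      column-CopTurn⁻¹ (caught d) with DistLe-0⇒≡ P d
      ... | refl = caught (DistLe-refl H)
      column-CopTurn⁻¹ (copMove (_ , h″) (inj₁ refl) t) =
        copMove h″ (inj₁ refl) (column-RobTurn⁻¹ t)
      column-CopTurn⁻¹ (copMove (_ , h″) (inj₂ (inj₂ (refl , a))) t) =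
        copMove h″ (inj₂ a) (column-RobTurn⁻¹ t)
      column-CopTurn⁻¹ (copMove (_ , h″) (inj₂ (inj₁ g~g′)) t) =
        ⊥-elim (H-escapes (h″ , leave-column g~g′ t))

      column-RobTurn⁻¹ : ∀ {g h h′} → RobTurn P 0 (g , h) (g , h′) → RobTurn H 0 h h′
      column-RobTurn⁻¹ (caught d) with DistLe-0⇒≡ P d
      ... | refl = caught (DistLe-refl H)
      column-RobTurn⁻¹ (robMove f) =
        robMove λ h″ s → column-CopTurn⁻¹ (f _ (column-Step s))

      leave-column : ∀ {g g′ h h′} →
                     Adj G g g′ → RobTurn P 0 (g′ , h) (g , h′) → ∀ h″ → CopTurn H 0 h h″
      leave-column g~g′ (caught d) _ with DistLe-0⇒≡ P d
      ... | refl = ⊥-elim (Adj-irr G g~g′)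
      leave-column g~g′ (robMove f) h″ =
        column-CopTurn⁻¹ (f (_ , h″) (inj₂ (inj₁ g~g′)))

    ¬CWRC-0-lexProd : ¬ CWRC P 0
    ¬CWRC-0-lexProd ((g , h) , win) =
      H-escapes (h , λ h′ → column-CopTurn⁻¹ (win (g , h′)))

  rc-lexProd-positive : (∀ g → ∃ (Adj G g)) → B → ∀ {k} → 1 ≤ k → IsRc G k → IsRc P k
  rc-lexProd-positive no-isolated h₀ 1≤k (G-win , G-least) =
    CWRC-lift no-isolated 1≤k h₀ G-win , λ j P-win → G-least j (CWRC-project h₀ P-win)

  rc-lexProd-zero : (∀ g → ∃ (Adj G g)) → B → IsRc G 0 → ∀ j → IsRc H j → IsRc P (1 ⊓ j)
  rc-lexProd-zero _ _ (G-win , _) zero (H-win , _) =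
    CWRC-0-lexProd G-win H-win , λ _ _ → z≤n
  rc-lexProd-zero no-isolated h₀ (G-win , _) (suc j) (_ , H-least) =
    CWRC-lift no-isolated ≤-refl h₀ (CWRC-mono G z≤n G-win) , positive
    where
    positive : ∀ i → CWRC P i → 1 ≤ i
    positive zero P-win = ⊥-elim (¬CWRC-0-lexProd (n≮0 ∘ H-least 0) P-win)
    positive (suc _) _ = s≤s z≤n

theorem5p11 : ∀ {n m : ℕ} (G : Graph (Fin n)) (H : Graph (Fin m)) →
              2 ≤ n → 2 ≤ m → Connected G → Connected H →
              ∀ (k : ℕ) → IsRc G k →
                ((1 ≤ k → IsRc (lexProd G H) k) ×
                 (k ≡ 0 → ∀ (j : ℕ) → IsRc H j → IsRc (lexProd G H) (1 ⊓ j)))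
theorem5p11 G H (s≤s (s≤s z≤n)) (s≤s _) G-connected _ k G-rc =
    (λ 1≤k → rc-lexProd-positive G H no-isolated zero 1≤k G-rc)
  , (λ k≡0 → rc-lexProd-zero G H no-isolated zero (subst (IsRc G) k≡0 G-rc))
  where
  no-isolated : ∀ g → ∃ (Adj G g)
  no-isolated =
    connected⇒no-isolated G G-connected (λ g → punchIn g zero , punchInᵢ≢i g zero ∘ sym)
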